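{- Let $G$ be a graph with a fixed total order on its edges, and let $d,\ell,p$ be integers. If $(A,B)$ is a $d$-sparse and $d$-localized pair with no independent subpair of size $p$, then the size of $(A,B)$ is at most $2d\cdot p^3$.
   Context: $d(x,y)$ is shortest-path distance in $G$ and $B(x,k)=\{y: d(x,y)\le k\}$. Extend the edge order to paths by comparing from the end: a path with no edge is smallest; if two paths have the same last edge compare them with that edge removed; otherwise compare their last edges. For vertices $a,b$, $P_{ab}$ is the path from $a$ to $b$ of minimum length that is smallest in this order among minimum-length paths. A pair $(A,B)$ consists of two disjoint vertex sets; its size is $\min(|A|,|B|)$; a subpair is $(A',B')$ with $A'\subseteq A$, $B'\subseteq B$. $(A,B)$ is $d$-sparse if no vertex lies in more than $d$ of the balls $B(x,\ell)$, $x\in A\cup B$. $(A,B)$ is $d$-localized if the vertices of $A\cup B$ are pairwise at distance at least $\ell+1$ and $d(a,b)\le 2\ell-2^{d+2}-3$ for all $a\in A,b\in B$. For $a\in A,b\in B$, the critical vertex $c_{ab}$ (resp. $c_{ba}$) is the vertex of $P_{ab}$ at distance $\ell-3$ from $a$ (resp. from $b$). A $d$-localized pair $(A,B)$ is independent if for all $a\in A,b\in B$: $B(c_{ab},\ell)\cap(A\cup B)=\{a,b\}$ and $B(c_{ba},\ell)\cap(A\cup B)=\{a,b\}$. -}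

module Defs where

open import Data.Nat using (ℕ; zero; suc; _+_; _*_; _∸_; _^_; _≤_; _<_)
open import Data.Fin using (Fin)
open import Data.Fin.Subset using (Subset; _∈_; _⊆_; _∪_; ∣_∣)
open import Data.List using (List; []; _∷_; length; map; reverse)
open import Data.Maybe using (Maybe; just; nothing)
open import Data.Product using (_×_; Σ; ∃; ∃-syntax; _,_)
open import Data.Sum using (_⊎_)
open import Data.Empty using (⊥)
open import Relation.Nullary using (¬_)
open import Relation.Binary.PropositionalEquality using (_≡_)
open import Function.Bundles using (_⇔_)

record Graph (n : ℕ) : Set₁ where
  field
    E      : Fin n → Fin n → Set
    E-sym  : ∀ {u v} → E u v → E v u
    E-irr  : ∀ {u} → ¬ E u u

-- A graph together with a fixed total order on its edges, given by an
-- injective rank function on (unordered) edges: edge {u,v} precedes edge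
-- {x,y} iff rank u v < rank x y.
record OrderedGraph (n : ℕ) : Set₁ where
  field
    graph     : Graph n
  open Graph graph public
  field
    rank      : Fin n → Fin n → ℕ
    rank-sym  : ∀ u v → rank u v ≡ rank v u
    rank-inj  : ∀ {u v x y} → E u v → E x y → rank u v ≡ rank x y →
                (u ≡ x × v ≡ y) ⊎ (u ≡ y × v ≡ x)

module _ {n : ℕ} (G : OrderedGraph n) where
  open OrderedGraph G

  data Walk : Fin n → Fin n → List (Fin n) → Set where
    here : ∀ {a} → Walk a a (a ∷ [])
    step : ∀ {a x b vs} → E a x → Walk x b (x ∷ vs) → Walk a b (a ∷ x ∷ vs)

  len : List (Fin n) → ℕ
  len vs = length vs ∸ 1

  DistLe : Fin n → Fin n → ℕ → Set
  DistLe x y k = ∃[ vs ] (Walk x y vs × len vs ≤ k)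

  InBall : Fin n → ℕ → Fin n → Set
  InBall x k y = DistLe x y k

  edges : List (Fin n) → List (Fin n × Fin n)
  edges []           = []
  edges (x ∷ [])     = []
  edges (x ∷ y ∷ vs) = (x , y) ∷ edges (y ∷ vs)

  edgeRank : Fin n × Fin n → ℕ
  edgeRank (u , v) = rank u v

  -- Lexicographic order on edge lists read from the END (lists are reversed
  -- before comparison; edges are represented by their ranks).
  data _<R_ : List ℕ → List ℕ → Set where
    nil<  : ∀ {y ys} → [] <R (y ∷ ys)
    same< : ∀ {x xs ys} → xs <R ys → (x ∷ xs) <R (x ∷ ys)
    last< : ∀ {x y xs ys} → x < y → (x ∷ xs) <R (y ∷ ys)

  _<P_ : List (Fin n) → List (Fin n) → Set
  P <P Q = reverse (map edgeRank (edges P)) <R reverse (map edgeRank (edges Q))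

  IsP : Fin n → Fin n → List (Fin n) → Set
  IsP a b P = Walk a b P
            × (∀ Q → Walk a b Q → len P ≤ len Q)
            × (∀ Q → Walk a b Q → len Q ≡ len P → P ≡ Q ⊎ P <P Q)

  -- i-th vertex (0-based) of a list
  at : List (Fin n) → ℕ → Maybe (Fin n)
  at []       _       = nothing
  at (x ∷ xs) zero    = just x
  at (x ∷ xs) (suc i) = at xs i

  Disjoint : Subset n → Subset n → Set
  Disjoint A B = ∀ x → x ∈ A → x ∈ B → ⊥

  size : Subset n → Subset n → ℕ
  size A B = Data.Nat._⊓_ ∣ A ∣ ∣ B ∣

  Sparse : ℕ → ℕ → Subset n → Subset n → Set
  Sparse ℓ d A B = ∀ (v : Fin n) (S : Subset n) → S ⊆ (A ∪ B) →
                   (∀ x → x ∈ S → InBall x ℓ v) → ∣ S ∣ ≤ d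

  -- (A,B) is d-localized (w.r.t. ℓ).  The bound d(a,b) ≤ 2ℓ - 2^(d+2) - 3
  -- is written without truncated subtraction.
  Localized : ℕ → ℕ → Subset n → Subset n → Set
  Localized ℓ d A B =
      (∀ x y → x ∈ (A ∪ B) → y ∈ (A ∪ B) → ¬ x ≡ y → ¬ DistLe x y ℓ)
    × (∀ a b → a ∈ A → b ∈ B →
         ∃[ k ] (k + 2 ^ (d + 2) + 3 ≤ 2 * ℓ × DistLe a b k))

  BallMeets : ℕ → Subset n → Subset n → Fin n → Fin n → Fin n → Set
  BallMeets ℓ A B c a b = ∀ v → v ∈ (A ∪ B) → (InBall c ℓ v ⇔ (v ≡ a ⊎ v ≡ b))

  -- independence: c_ab is the vertex of P_ab at distance ℓ-3 from a,
  -- c_ba the vertex of P_ab at distance ℓ-3 from b.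
  Independent : ℕ → ℕ → Subset n → Subset n → Set
  Independent ℓ d A B =
      Localized ℓ d A B
    × (∀ a b → a ∈ A → b ∈ B → ∀ P → IsP a b P →
         (∀ c → at P (ℓ ∸ 3) ≡ just c → BallMeets ℓ A B c a b)
       × (∀ c → at (reverse P) (ℓ ∸ 3) ≡ just c → BallMeets ℓ A B c a b))

  HasIndepSubpair : ℕ → ℕ → ℕ → Subset n → Subset n → Set
  HasIndepSubpair ℓ d p A B =
    ∃[ A' ] ∃[ B' ] (A' ⊆ A × B' ⊆ B × Independent ℓ d A' B' × size A' B' ≡ p)

module Submission where

-- The paper's probabilistic argument, done by exact counting.  Call y a stray vertex
-- of (a, b) if y ∉ {a, b} lies in the ℓ-ball around c_ab or c_ba, and let the weight
-- of y relative to (a, b) count these two balls.  Localization keeps P_ab short, so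
-- a and b lie in both balls; sparsity then bounds the weight a pair a ∈ A, b ∈ B
-- gives to A ∪ B by D = 2(d - 1), and a subpair without weight among its members is
-- independent.  If size (A, B) > 2dp³, then d ≥ 1 and A, B contain p blocks of
-- M = p²D + 1 vertices each.  Choosing one vertex per block at random, a chosen pair
-- receives expected weight at most D/M from the chosen vertices, so the expected
-- total is below p²D/M < 1 and some choice is weightless.
--
-- Membership in critical balls
-- is decidable only up to double negation, which suffices since the conclusion is
-- a decidable inequality.

open import Defs
open import Data.Bool using (true; false)
open import Data.Empty using (⊥; ⊥-elim)
open import Data.Fin using (Fin; zero; suc; punchIn; punchOut; _↑ˡ_; _↑ʳ_; combine; inject≤; fromℕ<; _≟_)
open import Data.Fin.Properties
  using (punchIn-punchOut; punchOut-injective; suc-injective; any?;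
         combine-injectiveˡ; inject≤-injective)
open import Data.Fin.Subset using (Subset; _∈_; _⊆_; _∪_; ∣_∣; ⁅_⁆) renaming (⊥ to ∅)
open import Data.Fin.Subset.Properties
  using (_∈?_; ⊆-min; ∣⊥∣≡0; x∈p∪q⁻; p⊆p∪q; q⊆p∪q; x∈⁅y⁆⇒x≡y; ∣⁅x⁆∣≡1)
open import Data.List using (List; []; _∷_; _++_; length; reverse)
open import Data.List.Properties using (unfold-reverse; length-reverse)
open import Data.Maybe using (just)
open import Data.Nat
  using (ℕ; zero; suc; _+_; _*_; _∸_; _^_; _≤_; _<_; _⊓_; z≤n; s≤s; pred; _≤?_; _<?_; >-nonZero)
open import Data.Nat.Properties
  using (+-*-semiring; *-commutativeSemigroup; ≤-refl; ≤-reflexive; ≤-trans; ≤-antisym; ≤-<-trans;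
         <-irrefl; <-asym; <⇒≤; <⇒≤pred; ≤⇒≯; ≮⇒≥; ≰⇒>; n<1⇒n≡0; 1+n≢0; module ≤-Reasoning;
         +-assoc; +-comm; +-identityʳ; +-mono-≤; +-monoˡ-≤; +-monoʳ-≤; +-mono-<-≤; +-cancelˡ-≤;
         m+n≡0⇒m≡0; m+n≡0⇒n≡0; m≤m+n; m≤n+m; m∸n≤m; m≤n+m∸n; m≤n+o⇒m∸n≤o;
         *-assoc; *-identityˡ; *-identityʳ; *-zeroʳ; *-suc; *-distribˡ-+; *-distribʳ-+;
         *-mono-≤; *-monoˡ-≤; *-monoʳ-≤; *-monoʳ-<; *-cancelˡ-<; m≤m*n; m^n>0; ^-monoʳ-≤;
         m⊓n≤m; m⊓n≤n; ⊓-idem)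
open import Data.Nat.Tactic.RingSolver using (solve-∀)
open import Data.Product using (_×_; _,_; proj₁; proj₂; ∃-syntax; swap)
open import Data.Sum using (_⊎_; inj₁; inj₂)
open import Data.Vec using ([]; _∷_; here; there)
open import Data.Vec.Functional using (head; tail) renaming (_∷_ to _◂_)
open import Function using (id; _∘_)
open import Function.Bundles using (mk⇔)
open import Function.Definitions using (Injective)
open import Relation.Nullary using (¬_; Dec; yes; no; does; contradiction)
open import Relation.Nullary.Decidable using (_×-dec_; ¬?; ¬¬-excluded-middle)
open import Relation.Binary.PropositionalEquality
open import Algebra.Properties.CommutativeSemigroup *-commutativeSemigroup using (x∙yz≈y∙xz)
open import Algebra.Properties.Semiring.Sum +-*-semiring
  using (sum; sum-syntax; sum-cong-≗; ∑-distrib-+; ∑-comm; *-distribˡ-sum; sum-remove)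

∑-const : ∀ m c → ∑[ i < m ] c ≡ m * c
∑-const zero    c = refl
∑-const (suc m) c = cong (c +_) (∑-const m c)

∑-mono : ∀ {m} {f g : Fin m → ℕ} → (∀ i → f i ≤ g i) → sum f ≤ sum g
∑-mono {zero}  f≤g = z≤n
∑-mono {suc m} f≤g = +-mono-≤ (f≤g zero) (∑-mono (f≤g ∘ suc))

term≤∑ : ∀ {m} (f : Fin m → ℕ) i → f i ≤ sum f
term≤∑ f zero    = m≤m+n _ _
term≤∑ f (suc i) = ≤-trans (term≤∑ (f ∘ suc) i) (m≤n+m _ _)

∑-<⇒< : ∀ {m} (f g : Fin m → ℕ) → sum f < sum g → ∃[ i ] f i < g i
∑-<⇒< {zero}  f g ()
∑-<⇒< {suc m} f g ∑f<∑g with f zero <? g zero | sum (f ∘ suc) <? sum (g ∘ suc)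
... | yes f₀<g₀ | _     = zero , f₀<g₀
... | no _      | yes r with ∑-<⇒< (f ∘ suc) (g ∘ suc) r
...   | i , fᵢ<gᵢ = suc i , fᵢ<gᵢ
∑-<⇒< {suc m} f g ∑f<∑g | no f₀≮g₀ | no r =
  contradiction ∑f<∑g (≤⇒≯ (+-mono-≤ (≮⇒≥ f₀≮g₀) (≮⇒≥ r)))

∑-mono-< : ∀ {m} {f g : Fin m → ℕ} (i : Fin m) → f i < g i → (∀ j → f j ≤ g j) → sum f < sum g
∑-mono-< {suc m} {f} {g} i fᵢ<gᵢ f≤g = begin-strict
  sum f                                 ≡⟨ sum-remove f ⟩
  f i + ∑[ j < m ] f (punchIn i j)      <⟨ +-mono-<-≤ fᵢ<gᵢ (∑-mono (f≤g ∘ punchIn i)) ⟩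
  g i + ∑[ j < m ] g (punchIn i j)      ≡⟨ sum-remove g ⟨
  sum g                                 ∎
  where open ≤-Reasoning

∑-inject : ∀ {m k} (γ : Fin m → Fin k) → Injective _≡_ _≡_ γ →
           (g : Fin k → ℕ) → ∑[ t < m ] g (γ t) ≤ sum g
∑-inject {zero}          γ γ-inj g = z≤n
∑-inject {suc m} {zero}  γ γ-inj g with () ← γ zero
∑-inject {suc m} {suc k} γ γ-inj g = begin
  g (γ zero) + ∑[ t < m ] g (γ (suc t))
    ≡⟨ cong (g (γ zero) +_) (sum-cong-≗ (cong g ∘ sym ∘ punchIn-punchOut ∘ γ₀≢)) ⟩
  g (γ zero) + ∑[ t < m ] g (punchIn (γ zero) (γ′ t))
    ≤⟨ +-monoʳ-≤ (g (γ zero)) (∑-inject γ′ γ′-inj (g ∘ punchIn (γ zero))) ⟩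
  g (γ zero) + ∑[ j < k ] g (punchIn (γ zero) j)
    ≡⟨ sum-remove g ⟨
  sum g
    ∎
  where
  open ≤-Reasoning
  -- the rest of γ avoids γ zero, so it factors through Fin k by punching out γ zero
  γ₀≢ : ∀ t → γ zero ≢ γ (suc t)
  γ₀≢ t eq with () ← γ-inj eq
  γ′ : Fin m → Fin k
  γ′ t = punchOut (γ₀≢ t)
  γ′-inj : Injective _≡_ _≡_ γ′
  γ′-inj eq = suc-injective (γ-inj (punchOut-injective (γ₀≢ _) (γ₀≢ _) eq))

∑-split : ∀ m {k} (h : Fin (m + k) → ℕ) →
          sum h ≡ ∑[ i < m ] h (i ↑ˡ k) + ∑[ j < k ] h (m ↑ʳ j)
∑-split zero    h = refl
∑-split (suc m) h = trans (cong (h zero +_) (∑-split m (h ∘ suc))) (sym (+-assoc (h zero) _ _))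

∑-blocks : ∀ p {M} (h : Fin (p * M) → ℕ) → ∑[ i < p ] ∑[ u < M ] h (combine i u) ≡ sum h
∑-blocks zero    h = refl
∑-blocks (suc p) {M} h =
  trans (cong (∑[ u < M ] h (u ↑ˡ p * M) +_) (∑-blocks p (h ∘ (M ↑ʳ_)))) (sym (∑-split M h))

-- Sums over all tuples of length q with entries in Fin M, i.e. over the uniform
-- distribution on such tuples, scaled by M ^ q.
module TupleSums (M : ℕ) where

  Tuple : ℕ → Set
  Tuple q = Fin q → Fin M

  ∑ᵀ : ∀ q → (Tuple q → ℕ) → ℕ
  ∑ᵀ zero    f = f (λ ())
  ∑ᵀ (suc q) f = ∑[ x < M ] ∑ᵀ q (λ v → f (x ◂ v))

  ∑ᵀ-cong : ∀ q {f g : Tuple q → ℕ} → (∀ v → f v ≡ g v) → ∑ᵀ q f ≡ ∑ᵀ q g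
  ∑ᵀ-cong zero    f≗g = f≗g (λ ())
  ∑ᵀ-cong (suc q) f≗g = sum-cong-≗ (λ x → ∑ᵀ-cong q (λ v → f≗g (x ◂ v)))

  ∑ᵀ-distrib-+ : ∀ q (f g : Tuple q → ℕ) → ∑ᵀ q (λ v → f v + g v) ≡ ∑ᵀ q f + ∑ᵀ q g
  ∑ᵀ-distrib-+ zero    f g = refl
  ∑ᵀ-distrib-+ (suc q) f g = begin
    ∑[ x < M ] ∑ᵀ q (λ v → f (x ◂ v) + g (x ◂ v))
      ≡⟨ sum-cong-≗ (λ x → ∑ᵀ-distrib-+ q (λ v → f (x ◂ v)) (λ v → g (x ◂ v))) ⟩
    ∑[ x < M ] (∑ᵀ q (λ v → f (x ◂ v)) + ∑ᵀ q (λ v → g (x ◂ v)))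
      ≡⟨ ∑-distrib-+ (λ x → ∑ᵀ q (λ v → f (x ◂ v))) (λ x → ∑ᵀ q (λ v → g (x ◂ v))) ⟩
    ∑ᵀ (suc q) f + ∑ᵀ (suc q) g
      ∎
    where open ≡-Reasoning

  ∑ᵀ-*ˡ : ∀ q c (f : Tuple q → ℕ) → ∑ᵀ q (λ v → c * f v) ≡ c * ∑ᵀ q f
  ∑ᵀ-*ˡ zero    c f = refl
  ∑ᵀ-*ˡ (suc q) c f = begin
    ∑[ x < M ] ∑ᵀ q (λ v → c * f (x ◂ v))   ≡⟨ sum-cong-≗ (λ x → ∑ᵀ-*ˡ q c (λ v → f (x ◂ v))) ⟩
    ∑[ x < M ] (c * ∑ᵀ q (λ v → f (x ◂ v))) ≡⟨ *-distribˡ-sum c (λ x → ∑ᵀ q (λ v → f (x ◂ v))) ⟨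
    c * ∑ᵀ (suc q) f                         ∎
    where open ≡-Reasoning

  ∑ᵀ-const : ∀ q c → ∑ᵀ q (λ _ → c) ≡ M ^ q * c
  ∑ᵀ-const zero    c = sym (*-identityˡ c)
  ∑ᵀ-const (suc q) c = begin
    ∑[ x < M ] ∑ᵀ q (λ _ → c)  ≡⟨ cong (λ s → ∑[ x < M ] s) (∑ᵀ-const q c) ⟩
    ∑[ x < M ] (M ^ q * c)     ≡⟨ ∑-const M (M ^ q * c) ⟩
    M * (M ^ q * c)            ≡⟨ *-assoc M _ c ⟨
    M ^ suc q * c              ∎
    where open ≡-Reasoning

  ∑ᵀ-∑ : ∀ q {m} (h : Tuple q → Fin m → ℕ) →
         ∑ᵀ q (λ v → ∑[ i < m ] h v i) ≡ ∑[ i < m ] ∑ᵀ q (λ v → h v i)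
  ∑ᵀ-∑ zero    h = refl
  ∑ᵀ-∑ (suc q) {m} h = begin
    ∑[ x < M ] ∑ᵀ q (λ v → ∑[ i < m ] h (x ◂ v) i)   ≡⟨ sum-cong-≗ (λ x → ∑ᵀ-∑ q (λ v → h (x ◂ v))) ⟩
    ∑[ x < M ] ∑[ i < m ] ∑ᵀ q (λ v → h (x ◂ v) i)   ≡⟨ ∑-comm (λ x i → ∑ᵀ q (λ v → h (x ◂ v) i)) ⟩
    ∑[ i < m ] ∑ᵀ (suc q) (λ v → h v i)              ∎
    where open ≡-Reasoning

  ∑ᵀ-comm : ∀ q r (F : Tuple q → Tuple r → ℕ) →
            ∑ᵀ q (λ v → ∑ᵀ r (F v)) ≡ ∑ᵀ r (λ w → ∑ᵀ q (λ v → F v w))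
  ∑ᵀ-comm zero    r F = refl
  ∑ᵀ-comm (suc q) r F = begin
    ∑[ x < M ] ∑ᵀ q (λ v → ∑ᵀ r (F (x ◂ v)))       ≡⟨ sum-cong-≗ (λ x → ∑ᵀ-comm q r (F ∘ (x ◂_))) ⟩
    ∑[ x < M ] ∑ᵀ r (λ w → ∑ᵀ q (λ v → F (x ◂ v) w)) ≡⟨ ∑ᵀ-∑ r (λ w x → ∑ᵀ q (λ v → F (x ◂ v) w)) ⟨
    ∑ᵀ r (λ w → ∑ᵀ (suc q) (λ v → F v w))           ∎
    where open ≡-Reasoning

  ∑ᵀ-<⇒< : ∀ q (f g : Tuple q → ℕ) → ∑ᵀ q f < ∑ᵀ q g → ∃[ v ] f v < g v
  ∑ᵀ-<⇒< zero    f g lt = (λ ()) , lt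
  ∑ᵀ-<⇒< (suc q) f g lt with ∑-<⇒< (λ x → ∑ᵀ q (λ v → f (x ◂ v))) (λ x → ∑ᵀ q (λ v → g (x ◂ v))) lt
  ... | x , ltₓ with ∑ᵀ-<⇒< q (λ v → f (x ◂ v)) (λ v → g (x ◂ v)) ltₓ
  ...   | v , ltᵥ = x ◂ v , ltᵥ

  insert : ∀ {q} → Fin (suc q) → Fin M → Tuple q → Tuple (suc q)
  insert         zero    x u = x ◂ u
  insert {suc q} (suc i) x u = head u ◂ insert i x (tail u)

  insert-here : ∀ {q} (i : Fin (suc q)) x u → insert i x u i ≡ x
  insert-here         zero    x u = refl
  insert-here {suc q} (suc i) x u = insert-here i x (tail u)

  insert-punchIn : ∀ {q} (i : Fin (suc q)) x u j → insert i x u (punchIn i j) ≡ u j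
  insert-punchIn         zero    x u j       = refl
  insert-punchIn {suc q} (suc i) x u zero    = refl
  insert-punchIn {suc q} (suc i) x u (suc j) = insert-punchIn i x (tail u) j

  ∑ᵀ-insert : ∀ {q} (i : Fin (suc q)) (f : Tuple (suc q) → ℕ) →
              ∑ᵀ (suc q) f ≡ ∑[ x < M ] ∑ᵀ q (λ u → f (insert i x u))
  ∑ᵀ-insert         zero    f = refl
  ∑ᵀ-insert {suc q} (suc i) f = begin
    ∑[ y < M ] ∑ᵀ (suc q) (λ v → f (y ◂ v))
      ≡⟨ sum-cong-≗ (λ y → ∑ᵀ-insert i (λ v → f (y ◂ v))) ⟩
    ∑[ y < M ] ∑[ x < M ] ∑ᵀ q (λ u → f (y ◂ insert i x u))
      ≡⟨ ∑-comm (λ y x → ∑ᵀ q (λ u → f (y ◂ insert i x u))) ⟩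
    ∑[ x < M ] ∑ᵀ (suc q) (λ u → f (insert (suc i) x u))
      ∎
    where open ≡-Reasoning

  marginal₁ : ∀ {q} (i : Fin q) (h : Fin M → ℕ) →
              M * ∑ᵀ q (λ v → h (v i)) ≡ M ^ q * sum h
  marginal₁ {suc q} i h = begin
    M * ∑ᵀ (suc q) (λ v → h (v i))                   ≡⟨ cong (M *_) (∑ᵀ-insert i (λ v → h (v i))) ⟩
    M * ∑[ x < M ] ∑ᵀ q (λ u → h (insert i x u i))   ≡⟨ cong (M *_) (sum-cong-≗ λ x →
                                                         ∑ᵀ-cong q (λ u → cong h (insert-here i x u))) ⟩
    M * ∑[ x < M ] ∑ᵀ q (λ _ → h x)                  ≡⟨ cong (M *_) (sum-cong-≗ λ x → ∑ᵀ-const q (h x)) ⟩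
    M * ∑[ x < M ] (M ^ q * h x)                     ≡⟨ cong (M *_) (*-distribˡ-sum (M ^ q) h) ⟨
    M * (M ^ q * sum h)                              ≡⟨ *-assoc M _ _ ⟨
    M ^ suc q * sum h                                ∎
    where open ≡-Reasoning

  marginal₂ : ∀ {q} {i k : Fin q} → i ≢ k → (h : Fin M → Fin M → ℕ) →
              M * (M * ∑ᵀ q (λ v → h (v i) (v k))) ≡ M ^ q * ∑[ x < M ] ∑[ y < M ] h x y
  marginal₂ {suc q} {i} {k} i≢k h = begin
    M * (M * ∑ᵀ (suc q) (λ v → h (v i) (v k)))
      ≡⟨ cong (λ s → M * (M * s)) (∑ᵀ-insert i (λ v → h (v i) (v k))) ⟩
    M * (M * ∑[ x < M ] ∑ᵀ q (λ u → h (insert i x u i) (insert i x u k)))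
      ≡⟨ cong (λ s → M * (M * s))
              (sum-cong-≗ λ x → ∑ᵀ-cong q λ u → cong₂ h (insert-here i x u) insert-k) ⟩
    M * (M * ∑[ x < M ] ∑ᵀ q (λ u → h x (u k′)))
      ≡⟨ cong (M *_) (*-distribˡ-sum M (λ x → ∑ᵀ q (λ u → h x (u k′)))) ⟩
    M * ∑[ x < M ] (M * ∑ᵀ q (λ u → h x (u k′)))
      ≡⟨ cong (M *_) (sum-cong-≗ λ x → marginal₁ k′ (h x)) ⟩
    M * ∑[ x < M ] (M ^ q * ∑[ y < M ] h x y)
      ≡⟨ cong (M *_) (*-distribˡ-sum (M ^ q) (λ x → ∑[ y < M ] h x y)) ⟨
    M * (M ^ q * ∑[ x < M ] ∑[ y < M ] h x y)
      ≡⟨ *-assoc M _ _ ⟨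
    M ^ suc q * ∑[ x < M ] ∑[ y < M ] h x y
      ∎
    where
    open ≡-Reasoning
    k′ : Fin q
    k′ = punchOut i≢k
    insert-k : ∀ {x u} → insert i x u k ≡ u k′
    insert-k {x} {u} = trans (cong (insert i x u) (sym (punchIn-punchOut i≢k))) (insert-punchIn i x u k′)

  pair-marginal : ∀ {q r} (i : Fin q) (G : Fin M → ℕ) (F : Tuple q → Tuple r → ℕ) →
    (∀ v → M * (M * ∑ᵀ r (F v)) ≡ M ^ r * G (v i)) →
    M * (M * (M * ∑ᵀ q (λ v → ∑ᵀ r (F v)))) ≡ M ^ q * (M ^ r * sum G)
  pair-marginal {q} {r} i G F inner = begin
    M * (M * (M * ∑ᵀ q (λ v → ∑ᵀ r (F v))))
      ≡⟨ cong (M *_) (trans (∑ᵀ-*ˡ q M (λ v → M * ∑ᵀ r (F v)))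
                             (cong (M *_) (∑ᵀ-*ˡ q M (λ v → ∑ᵀ r (F v))))) ⟨
    M * ∑ᵀ q (λ v → M * (M * ∑ᵀ r (F v)))
      ≡⟨ cong (M *_) (∑ᵀ-cong q inner) ⟩
    M * ∑ᵀ q (λ v → M ^ r * G (v i))
      ≡⟨ cong (M *_) (∑ᵀ-*ˡ q (M ^ r) (λ v → G (v i))) ⟩
    M * (M ^ r * ∑ᵀ q (λ v → G (v i)))
      ≡⟨ x∙yz≈y∙xz M (M ^ r) _ ⟩
    M ^ r * (M * ∑ᵀ q (λ v → G (v i)))
      ≡⟨ cong (M ^ r *_) (marginal₁ i G) ⟩
    M ^ r * (M ^ q * sum G)
      ≡⟨ x∙yz≈y∙xz (M ^ r) (M ^ q) _ ⟩
    M ^ q * (M ^ r * sum G)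
      ∎
    where open ≡-Reasoning

-- Choosing one element v k of each
-- α-block and w k of each β-block uniformly at random, the expected weight received
-- by a chosen pair is at most D/M, so the expected total weight is below p²D/M < 1:
-- some choice (v, w) is weightless.
module Transversal {X : Set} (M p D : ℕ) (α β : Fin p → Fin M → X)
  (g : X → X → X → ℕ) (g-a : ∀ a b → g a b a ≡ 0) (g-b : ∀ a b → g a b b ≡ 0)
  (budget : ∀ i u j u′ →
     ∑[ k < p ] ∑[ u″ < M ] g (α i u) (β j u′) (α k u″) +
     ∑[ k < p ] ∑[ u″ < M ] g (α i u) (β j u′) (β k u″) ≤ D)
  (M-large : p * p * D < M) where

  open TupleSums M

  -- M³ times the sum of F over all choices (v, w); this is the expectation of F
  -- scaled by M^(2p + 3), which keeps everything in ℕ.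
  𝔼 : (Tuple p → Tuple p → ℕ) → ℕ
  𝔼 F = M * (M * M) * ∑ᵀ p (λ v → ∑ᵀ p (F v))

  -- 𝔼 with the factor M³ spread out, the form produced by the marginal lemmas.
  𝔼-cube : ∀ F → 𝔼 F ≡ M * (M * (M * ∑ᵀ p (λ v → ∑ᵀ p (F v))))
  𝔼-cube F = cube M _
    where
    cube : ∀ m s → m * (m * m) * s ≡ m * (m * (m * s))
    cube = solve-∀

  𝔼-+ : ∀ F G → 𝔼 (λ v w → F v w + G v w) ≡ 𝔼 F + 𝔼 G
  𝔼-+ F G = begin
    M * (M * M) * ∑ᵀ p (λ v → ∑ᵀ p (λ w → F v w + G v w))
      ≡⟨ cong (M * (M * M) *_) (trans (∑ᵀ-cong p (λ v → ∑ᵀ-distrib-+ p (F v) (G v)))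
                                       (∑ᵀ-distrib-+ p _ _)) ⟩
    M * (M * M) * (∑ᵀ p (λ v → ∑ᵀ p (F v)) + ∑ᵀ p (λ v → ∑ᵀ p (G v)))
      ≡⟨ *-distribˡ-+ (M * (M * M)) _ _ ⟩
    𝔼 F + 𝔼 G
      ∎
    where open ≡-Reasoning

  𝔼-∑ : ∀ {m} (F : Tuple p → Tuple p → Fin m → ℕ) →
        𝔼 (λ v w → ∑[ k < m ] F v w k) ≡ ∑[ k < m ] 𝔼 (λ v w → F v w k)
  𝔼-∑ {m} F = begin
    M * (M * M) * ∑ᵀ p (λ v → ∑ᵀ p (λ w → ∑[ k < m ] F v w k))
      ≡⟨ cong (M * (M * M) *_) (trans (∑ᵀ-cong p (λ v → ∑ᵀ-∑ p (F v)))
                                       (∑ᵀ-∑ p (λ v k → ∑ᵀ p (λ w → F v w k)))) ⟩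
    M * (M * M) * ∑[ k < m ] ∑ᵀ p (λ v → ∑ᵀ p (λ w → F v w k))
      ≡⟨ *-distribˡ-sum (M * (M * M)) (λ k → ∑ᵀ p (λ v → ∑ᵀ p (λ w → F v w k))) ⟩
    ∑[ k < m ] 𝔼 (λ v w → F v w k)
      ∎
    where open ≡-Reasoning

  𝔼-zero : ∀ F → (∀ v w → F v w ≡ 0) → 𝔼 F ≡ 0
  𝔼-zero F F≡0 = begin
    M * (M * M) * ∑ᵀ p (λ v → ∑ᵀ p (F v))  ≡⟨ cong (M * (M * M) *_) (∑ᵀ-cong p λ v →
                                               trans (∑ᵀ-cong p (F≡0 v)) (∑ᵀ-zero p)) ⟩
    M * (M * M) * ∑ᵀ p (λ _ → 0)           ≡⟨ cong (M * (M * M) *_) (∑ᵀ-zero p) ⟩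
    M * (M * M) * 0                        ≡⟨ *-zeroʳ (M * (M * M)) ⟩
    0                                      ∎
    where
    open ≡-Reasoning
    ∑ᵀ-zero : ∀ q → ∑ᵀ q (λ _ → 0) ≡ 0
    ∑ᵀ-zero q = trans (∑ᵀ-const q 0) (*-zeroʳ (M ^ q))

  Sα Sβ : Fin p → Fin p → Fin p → ℕ
  Sα i j k = ∑[ u < M ] ∑[ u′ < M ] ∑[ u″ < M ] g (α i u) (β j u′) (α k u″)
  Sβ i j k = ∑[ u < M ] ∑[ u′ < M ] ∑[ u″ < M ] g (α i u) (β j u′) (β k u″)

  -- Expected weight of the chosen element of α k relative to the chosen pair from
  -- α i and β j: for i ≠ k all three are independent and uniform, for i = k it is 0.
  expected-α : ∀ i j k →
    𝔼 (λ v w → g (α i (v i)) (β j (w j)) (α k (v k))) ≤ M ^ p * (M ^ p * Sα i j k)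
  expected-α i j k with i ≟ k
  ... | yes refl = ≤-trans (≤-reflexive (𝔼-zero _ (λ v w → g-a _ _))) z≤n
  ... | no i≢k = ≤-reflexive (begin
    𝔼 (λ v w → h (v i) (w j) (v k))
      ≡⟨ 𝔼-cube _ ⟩
    M * (M * (M * ∑ᵀ p (λ v → ∑ᵀ p (λ w → h (v i) (w j) (v k)))))
      ≡⟨ cong (λ s → M * (M * (M * s))) (∑ᵀ-comm p p (λ v w → h (v i) (w j) (v k))) ⟩
    M * (M * (M * ∑ᵀ p (λ w → ∑ᵀ p (λ v → h (v i) (w j) (v k)))))
      ≡⟨ pair-marginal j (λ y → ∑[ x < M ] ∑[ z < M ] h x y z) (λ w v → h (v i) (w j) (v k))
           (λ w → marginal₂ i≢k (λ x z → h x (w j) z)) ⟩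
    M ^ p * (M ^ p * ∑[ y < M ] ∑[ x < M ] ∑[ z < M ] h x y z)
      ≡⟨ cong (λ s → M ^ p * (M ^ p * s)) (∑-comm (λ y x → ∑[ z < M ] h x y z)) ⟩
    M ^ p * (M ^ p * Sα i j k)
      ∎)
    where
    open ≡-Reasoning
    h : Fin M → Fin M → Fin M → ℕ
    h u u′ u″ = g (α i u) (β j u′) (α k u″)

  expected-β : ∀ i j k →
    𝔼 (λ v w → g (α i (v i)) (β j (w j)) (β k (w k))) ≤ M ^ p * (M ^ p * Sβ i j k)
  expected-β i j k with j ≟ k
  ... | yes refl = ≤-trans (≤-reflexive (𝔼-zero _ (λ v w → g-b _ _))) z≤n
  ... | no j≢k = ≤-reflexive (begin
    𝔼 (λ v w → h (v i) (w j) (w k))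
      ≡⟨ 𝔼-cube _ ⟩
    M * (M * (M * ∑ᵀ p (λ v → ∑ᵀ p (λ w → h (v i) (w j) (w k)))))
      ≡⟨ pair-marginal i (λ x → ∑[ y < M ] ∑[ z < M ] h x y z) (λ v w → h (v i) (w j) (w k))
           (λ v → marginal₂ j≢k (h (v i))) ⟩
    M ^ p * (M ^ p * Sβ i j k)
      ∎)
    where
    open ≡-Reasoning
    h : Fin M → Fin M → Fin M → ℕ
    h u u′ u″ = g (α i u) (β j u′) (β k u″)

  load : Tuple p → Tuple p → Fin p → Fin p → ℕ
  load v w i j = ∑[ k < p ] g a b (α k (v k)) + ∑[ k < p ] g a b (β k (w k))
    where
    a = α i (v i)
    b = β j (w j)

  budget-blocks : ∀ i j → ∑[ k < p ] Sα i j k + ∑[ k < p ] Sβ i j k ≤ M * (M * D)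
  budget-blocks i j = begin
    ∑[ k < p ] Sα i j k + ∑[ k < p ] Sβ i j k
      ≡⟨ cong₂ _+_ (pull (λ k u u′ → ∑[ u″ < M ] g (α i u) (β j u′) (α k u″)))
                   (pull (λ k u u′ → ∑[ u″ < M ] g (α i u) (β j u′) (β k u″))) ⟩
    ∑[ u < M ] ∑[ u′ < M ] Σα u u′ + ∑[ u < M ] ∑[ u′ < M ] Σβ u u′
      ≡⟨ ∑-distrib-+ (λ u → ∑[ u′ < M ] Σα u u′) (λ u → ∑[ u′ < M ] Σβ u u′) ⟨
    ∑[ u < M ] (∑[ u′ < M ] Σα u u′ + ∑[ u′ < M ] Σβ u u′)
      ≡⟨ sum-cong-≗ (λ u → ∑-distrib-+ (Σα u) (Σβ u)) ⟨
    ∑[ u < M ] ∑[ u′ < M ] (Σα u u′ + Σβ u u′)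
      ≤⟨ ∑-mono (λ u → ∑-mono (λ u′ → budget i u j u′)) ⟩
    ∑[ u < M ] ∑[ u′ < M ] D
      ≡⟨ trans (cong (λ s → ∑[ u < M ] s) (∑-const M D)) (∑-const M (M * D)) ⟩
    M * (M * D)
      ∎
    where
    open ≤-Reasoning
    Σα Σβ : Fin M → Fin M → ℕ
    Σα u u′ = ∑[ k < p ] ∑[ u″ < M ] g (α i u) (β j u′) (α k u″)
    Σβ u u′ = ∑[ k < p ] ∑[ u″ < M ] g (α i u) (β j u′) (β k u″)
    pull : (F : Fin p → Fin M → Fin M → ℕ) →
           ∑[ k < p ] ∑[ u < M ] ∑[ u′ < M ] F k u u′ ≡ ∑[ u < M ] ∑[ u′ < M ] ∑[ k < p ] F k u u′
    pull F = trans (∑-comm (λ k u → ∑[ u′ < M ] F k u u′))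
                   (sum-cong-≗ (λ u → ∑-comm (λ k u′ → F k u u′)))

  expected-load : ∀ i j → 𝔼 (λ v w → load v w i j) ≤ M ^ p * (M ^ p * (M * (M * D)))
  expected-load i j = begin
    𝔼 (λ v w → load v w i j)
      ≡⟨ 𝔼-+ (λ v w → ∑[ k < p ] Fα v w k) (λ v w → ∑[ k < p ] Fβ v w k) ⟩
    𝔼 (λ v w → ∑[ k < p ] Fα v w k) + 𝔼 (λ v w → ∑[ k < p ] Fβ v w k)
      ≡⟨ cong₂ _+_ (𝔼-∑ Fα) (𝔼-∑ Fβ) ⟩
    ∑[ k < p ] 𝔼 (λ v w → Fα v w k) + ∑[ k < p ] 𝔼 (λ v w → Fβ v w k)
      ≤⟨ +-mono-≤ (∑-mono (expected-α i j)) (∑-mono (expected-β i j)) ⟩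
    ∑[ k < p ] (M ^ p * (M ^ p * Sα i j k)) + ∑[ k < p ] (M ^ p * (M ^ p * Sβ i j k))
      ≡⟨ cong₂ _+_ (scale (Sα i j)) (scale (Sβ i j)) ⟩
    M ^ p * (M ^ p * ∑[ k < p ] Sα i j k) + M ^ p * (M ^ p * ∑[ k < p ] Sβ i j k)
      ≡⟨ distrib (M ^ p) (M ^ p) _ _ ⟩
    M ^ p * (M ^ p * (∑[ k < p ] Sα i j k + ∑[ k < p ] Sβ i j k))
      ≤⟨ *-monoʳ-≤ (M ^ p) (*-monoʳ-≤ (M ^ p) (budget-blocks i j)) ⟩
    M ^ p * (M ^ p * (M * (M * D)))
      ∎
    where
    open ≤-Reasoning
    Fα Fβ : Tuple p → Tuple p → Fin p → ℕ
    Fα v w k = g (α i (v i)) (β j (w j)) (α k (v k))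
    Fβ v w k = g (α i (v i)) (β j (w j)) (β k (w k))
    scale : (Y : Fin p → ℕ) → ∑[ k < p ] (M ^ p * (M ^ p * Y k)) ≡ M ^ p * (M ^ p * sum Y)
    scale Y = begin-equality
      ∑[ k < p ] (M ^ p * (M ^ p * Y k))  ≡⟨ *-distribˡ-sum (M ^ p) (λ k → M ^ p * Y k) ⟨
      M ^ p * ∑[ k < p ] (M ^ p * Y k)    ≡⟨ cong (M ^ p *_) (*-distribˡ-sum (M ^ p) Y) ⟨
      M ^ p * (M ^ p * sum Y)             ∎
    distrib : ∀ a b x y → a * (b * x) + a * (b * y) ≡ a * (b * (x + y))
    distrib = solve-∀

  total-load : Tuple p → Tuple p → ℕ
  total-load v w = ∑[ i < p ] ∑[ j < p ] load v w i j

  average-load<1 : 𝔼 total-load < 𝔼 (λ _ _ → 1)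
  average-load<1 = begin-strict
    𝔼 total-load
      ≡⟨ trans (𝔼-∑ (λ v w i → ∑[ j < p ] load v w i j))
               (sum-cong-≗ (λ i → 𝔼-∑ (λ v w j → load v w i j))) ⟩
    ∑[ i < p ] ∑[ j < p ] 𝔼 (λ v w → load v w i j)
      ≤⟨ ∑-mono (λ i → ∑-mono (λ j → expected-load i j)) ⟩
    ∑[ i < p ] ∑[ j < p ] E
      ≡⟨ trans (cong (λ s → ∑[ i < p ] s) (∑-const p E)) (∑-const p (p * E)) ⟩
    p * (p * E)
      ≡⟨ regroup p (M ^ p) M D ⟩
    C * (p * p * D)
      <⟨ *-monoʳ-< C {{>-nonZero C>0}} M-large ⟩
    C * M
      ≡⟨ regroup₁ (M ^ p) M ⟩
    M * (M * M) * (M ^ p * (M ^ p * 1))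
      ≡⟨ cong (M * (M * M) *_) (trans (∑ᵀ-cong p (λ v → ∑ᵀ-const p 1)) (∑ᵀ-const p (M ^ p * 1))) ⟨
    𝔼 (λ _ _ → 1)
      ∎
    where
    open ≤-Reasoning
    E C : ℕ
    E = M ^ p * (M ^ p * (M * (M * D)))
    C = M ^ p * (M ^ p * (M * M))
    M>0 : 0 < M
    M>0 = ≤-<-trans z≤n M-large
    Mᵖ>0 : 0 < M ^ p
    Mᵖ>0 = m^n>0 M {{>-nonZero M>0}} p
    C>0 : 0 < C
    C>0 = *-mono-≤ Mᵖ>0 (*-mono-≤ Mᵖ>0 (*-mono-≤ M>0 M>0))
    regroup : ∀ p m M D → p * (p * (m * (m * (M * (M * D))))) ≡ m * (m * (M * M)) * (p * p * D)
    regroup = solve-∀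
    regroup₁ : ∀ m M → m * (m * (M * M)) * M ≡ M * (M * M) * (m * (m * 1))
    regroup₁ = solve-∀

  transversal : ∃[ v ] ∃[ w ] ∀ i j k →
    g (α i (v i)) (β j (w j)) (α k (v k)) ≡ 0 × g (α i (v i)) (β j (w j)) (β k (w k)) ≡ 0
  transversal with ∑ᵀ-<⇒< p (λ v → ∑ᵀ p (total-load v)) (λ v → ∑ᵀ p (λ _ → 1))
                          (*-cancelˡ-< (M * (M * M)) _ _ average-load<1)
  ... | v , average-over-w<1 with ∑ᵀ-<⇒< p (total-load v) (λ _ → 1) average-over-w<1
  ...   | w , chosen-load<1 = v , w , λ i j k →
          n<1⇒n≡0 (≤-<-trans (≤-trans (m≤m+n _ _) (≤total-load i j k)) chosen-load<1) ,
          n<1⇒n≡0 (≤-<-trans (≤-trans (m≤n+m _ _) (≤total-load i j k)) chosen-load<1)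
    where
    ≤total-load : ∀ i j k →
      g (α i (v i)) (β j (w j)) (α k (v k)) + g (α i (v i)) (β j (w j)) (β k (w k)) ≤ total-load v w
    ≤total-load i j k =
      ≤-trans (+-mono-≤ (term≤∑ (λ k → g _ _ (α k (v k))) k) (term≤∑ (λ k → g _ _ (β k (w k))) k))
              (≤-trans (term≤∑ (load v w i) j) (term≤∑ (λ i → ∑[ j < p ] load v w i j) i))

𝟙 : {P : Set} → Dec P → ℕ
𝟙 (yes _) = 1
𝟙 (no _)  = 0

𝟙-yes : ∀ {P : Set} (P? : Dec P) → P → 𝟙 P? ≡ 1
𝟙-yes (yes _) _  = refl
𝟙-yes (no ¬p) p  = ⊥-elim (¬p p)

𝟙-no : ∀ {P : Set} (P? : Dec P) → ¬ P → 𝟙 P? ≡ 0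
𝟙-no (yes p) ¬p = ⊥-elim (¬p p)
𝟙-no (no _)  _  = refl

𝟙-∧ : ∀ {P Q R : Set} (P? : Dec P) (Q? : Dec Q) (R? : Dec R) → (P → Q → R) → 𝟙 P? * 𝟙 Q? ≤ 𝟙 R?
𝟙-∧ (yes p) (yes q) R? f = ≤-reflexive (sym (𝟙-yes R? (f p q)))
𝟙-∧ (yes _) (no _)  R? f = z≤n
𝟙-∧ (no _)  Q?      R? f = z≤n

collect : ∀ {n} {Q : Fin n → Set} → (∀ y → Dec (Q y)) → Subset n
collect {zero}  Q? = []
collect {suc n} Q? = does (Q? zero) ∷ collect (Q? ∘ suc)

∈-collect⁻ : ∀ {n} {Q : Fin n → Set} (Q? : ∀ y → Dec (Q y)) {y} → y ∈ collect Q? → Q y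
∈-collect⁻ Q? {zero} y∈ with Q? zero | y∈
... | yes q | _ = q
... | no _  | ()
∈-collect⁻ Q? {suc y} (there y∈) = ∈-collect⁻ (Q? ∘ suc) y∈

∣collect∣ : ∀ {n} {Q : Fin n → Set} (Q? : ∀ y → Dec (Q y)) → ∣ collect Q? ∣ ≡ ∑[ y < n ] 𝟙 (Q? y)
∣collect∣ {zero}  Q? = refl
∣collect∣ {suc n} Q? with Q? zero
... | yes _ = cong suc (∣collect∣ (Q? ∘ suc))
... | no _  = ∣collect∣ (Q? ∘ suc)

enum : ∀ {n} (S : Subset n) → Fin ∣ S ∣ → Fin n
enum (true ∷ S)  zero    = zero
enum (true ∷ S)  (suc t) = suc (enum S t)
enum (false ∷ S) t       = suc (enum S t)

enum-∈ : ∀ {n} (S : Subset n) t → enum S t ∈ S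
enum-∈ (true ∷ S)  zero    = here
enum-∈ (true ∷ S)  (suc t) = there (enum-∈ S t)
enum-∈ (false ∷ S) t       = there (enum-∈ S t)

enum-injective : ∀ {n} (S : Subset n) → Injective _≡_ _≡_ (enum S)
enum-injective (true ∷ S)  {zero}  {zero}  _  = refl
enum-injective (true ∷ S)  {suc t} {suc u} eq = cong suc (enum-injective S (suc-injective eq))
enum-injective (false ∷ S)                 eq = enum-injective S (suc-injective eq)

shrink : ∀ {n} (S : Subset n) p → p ≤ ∣ S ∣ → ∃[ S′ ] (S′ ⊆ S × ∣ S′ ∣ ≡ p)
shrink {n} S zero _ = ∅ , ⊆-min S , ∣⊥∣≡0 n
shrink (true ∷ S) (suc p) (s≤s p≤∣S∣) with shrink S p p≤∣S∣
... | S′ , S′⊆S , ∣S′∣≡p = true ∷ S′ , ∷-mono S′⊆S , cong suc ∣S′∣≡p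
  where
  ∷-mono : ∀ {n b} {S′ S : Subset n} → S′ ⊆ S → (b ∷ S′) ⊆ (b ∷ S)
  ∷-mono S′⊆S here      = here
  ∷-mono S′⊆S (there x) = there (S′⊆S x)
shrink (false ∷ S) (suc p) p<∣S∣ with shrink S (suc p) p<∣S∣
... | S′ , S′⊆S , ∣S′∣≡p = false ∷ S′ , (λ { (there x) → there (S′⊆S x) }) , ∣S′∣≡p

∑-within : ∀ {m n} (S : Subset n) (γ : Fin m → Fin n) → Injective _≡_ _≡_ γ → (∀ t → γ t ∈ S) →
           (h : Fin n → ℕ) → ∑[ t < m ] h (γ t) ≤ ∑[ y < n ] (𝟙 (y ∈? S) * h y)
∑-within S γ γ-inj γ∈S h = begin
  ∑[ t < _ ] h (γ t)
    ≡⟨ sum-cong-≗ (λ t → sym (trans (cong (_* h (γ t)) (𝟙-yes (γ t ∈? S) (γ∈S t)))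
                                    (+-identityʳ (h (γ t))))) ⟩
  ∑[ t < _ ] (𝟙 (γ t ∈? S) * h (γ t))
    ≤⟨ ∑-inject γ γ-inj (λ y → 𝟙 (y ∈? S) * h y) ⟩
  ∑[ y < _ ] (𝟙 (y ∈? S) * h y)
    ∎
  where open ≤-Reasoning

image : ∀ {m n} → (Fin m → Fin n) → Subset n
image γ = collect (λ y → any? (λ i → y ≟ γ i))

∈-image⁻ : ∀ {m n} (γ : Fin m → Fin n) {y} → y ∈ image γ → ∃[ i ] y ≡ γ i
∈-image⁻ γ = ∈-collect⁻ (λ y → any? (λ i → y ≟ γ i))

∣image∣ : ∀ {m n} (γ : Fin m → Fin n) → Injective _≡_ _≡_ γ → m ≤ ∣ image γ ∣
∣image∣ {m} {n} γ γ-inj = begin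
  m                                   ≡⟨ trans (∑-const m 1) (*-identityʳ m) ⟨
  ∑[ i < m ] 1                        ≡⟨ sum-cong-≗ (λ i → 𝟙-yes (γ∈? (γ i)) (i , refl)) ⟨
  ∑[ i < m ] 𝟙 (γ∈? (γ i))            ≤⟨ ∑-inject γ γ-inj (λ y → 𝟙 (γ∈? y)) ⟩
  ∑[ y < n ] 𝟙 (γ∈? y)                ≡⟨ ∣collect∣ γ∈? ⟨
  ∣ image γ ∣                         ∎
  where
  open ≤-Reasoning
  γ∈? : ∀ y → Dec (∃[ i ] y ≡ γ i)
  γ∈? y = any? (λ i → y ≟ γ i)

𝟙-∪ : ∀ {n} (A B : Subset n) → (∀ x → x ∈ A → x ∈ B → ⊥) →
      ∀ y → 𝟙 (y ∈? A) + 𝟙 (y ∈? B) ≤ 𝟙 (y ∈? A ∪ B)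
𝟙-∪ A B disjoint y with y ∈? A | y ∈? B
... | yes y∈A | yes y∈B = ⊥-elim (disjoint y y∈A y∈B)
... | yes y∈A | no _    = ≤-reflexive (sym (𝟙-yes (y ∈? A ∪ B) (p⊆p∪q B y∈A)))
... | no _    | yes y∈B = ≤-reflexive (sym (𝟙-yes (y ∈? A ∪ B) (q⊆p∪q A B y∈B)))
... | no _    | no _    = z≤n

∪-mono : ∀ {n} {A′ A B′ B : Subset n} → A′ ⊆ A → B′ ⊆ B → A′ ∪ B′ ⊆ A ∪ B
∪-mono {A′ = A′} {B′ = B′} A′⊆A B′⊆B x∈ with x∈p∪q⁻ A′ B′ x∈
... | inj₁ x∈A′ = p⊆p∪q _ (A′⊆A x∈A′)
... | inj₂ x∈B′ = q⊆p∪q _ _ (B′⊆B x∈B′)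

WeightlessSubpair : ∀ {n} → (Fin n → Fin n → Fin n → ℕ) → ℕ → Subset n → Subset n → Set
WeightlessSubpair g p A B = ∃[ A′ ] ∃[ B′ ] (A′ ⊆ A × B′ ⊆ B × ∣ A′ ∣ ≡ p × ∣ B′ ∣ ≡ p ×
  (∀ {a b y} → a ∈ A′ → b ∈ B′ → y ∈ A′ ∪ B′ → g a b y ≡ 0))

weightless-images : ∀ {n p} {A B : Subset n} (g : Fin n → Fin n → Fin n → ℕ) (a b : Fin p → Fin n) →
  Injective _≡_ _≡_ a → Injective _≡_ _≡_ b → (∀ i → a i ∈ A) → (∀ j → b j ∈ B) →
  (∀ i j k → g (a i) (b j) (a k) ≡ 0 × g (a i) (b j) (b k) ≡ 0) → WeightlessSubpair g p A B
weightless-images {p = p} {A} {B} g a b a-inj b-inj a∈A b∈B zeros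
  with shrink (image a) p (∣image∣ a a-inj) | shrink (image b) p (∣image∣ b b-inj)
... | A′ , A′⊆ , ∣A′∣≡p | B′ , B′⊆ , ∣B′∣≡p = A′ , B′ , A′⊆A , B′⊆B , ∣A′∣≡p , ∣B′∣≡p , weightless
  where
  A′⊆A : A′ ⊆ A
  A′⊆A x∈ with ∈-image⁻ a (A′⊆ x∈)
  ... | i , refl = a∈A i
  B′⊆B : B′ ⊆ B
  B′⊆B y∈ with ∈-image⁻ b (B′⊆ y∈)
  ... | j , refl = b∈B j
  weightless : ∀ {x y z} → x ∈ A′ → y ∈ B′ → z ∈ A′ ∪ B′ → g x y z ≡ 0
  weightless x∈ y∈ z∈ with ∈-image⁻ a (A′⊆ x∈) | ∈-image⁻ b (B′⊆ y∈) | x∈p∪q⁻ A′ B′ z∈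
  ... | i , refl | j , refl | inj₁ z∈A′ with ∈-image⁻ a (A′⊆ z∈A′)
  ...   | k , refl = proj₁ (zeros i j k)
  weightless x∈ y∈ z∈ | i , refl | j , refl | inj₂ z∈B′ with ∈-image⁻ b (B′⊆ z∈B′)
  ...   | k , refl = proj₂ (zeros i j k)

select : ∀ {n} (A B : Subset n) → (∀ x → x ∈ A → x ∈ B → ⊥) →
         (g : Fin n → Fin n → Fin n → ℕ) → (∀ a b → g a b a ≡ 0) → (∀ a b → g a b b ≡ 0) →
         ∀ D → (∀ {a b} → a ∈ A → b ∈ B → ∑[ y < n ] (𝟙 (y ∈? A ∪ B) * g a b y) ≤ D) →
         ∀ p M → p * M ≤ ∣ A ∣ → p * M ≤ ∣ B ∣ → p * p * D < M → WeightlessSubpair g p A B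
select {n} A B disjoint g g-a g-b D budget p M pM≤∣A∣ pM≤∣B∣ M-large =
  from-transversal (Transversal.transversal M p D α β g g-a g-b block-budget M-large)
  where
  γA γB : Fin (p * M) → Fin n
  γA t = enum A (inject≤ t pM≤∣A∣)
  γB t = enum B (inject≤ t pM≤∣B∣)
  γA-inj : Injective _≡_ _≡_ γA
  γA-inj eq = inject≤-injective _ _ _ _ (enum-injective A eq)
  γB-inj : Injective _≡_ _≡_ γB
  γB-inj eq = inject≤-injective _ _ _ _ (enum-injective B eq)
  α β : Fin p → Fin M → Fin n
  α i u = γA (combine i u)
  β j u = γB (combine j u)

  block-budget : ∀ i u j u′ →
    ∑[ k < p ] ∑[ u″ < M ] g (α i u) (β j u′) (α k u″) +
    ∑[ k < p ] ∑[ u″ < M ] g (α i u) (β j u′) (β k u″) ≤ D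
  block-budget i u j u′ = begin
    ∑[ k < p ] ∑[ u″ < M ] h (α k u″) + ∑[ k < p ] ∑[ u″ < M ] h (β k u″)
      ≡⟨ cong₂ _+_ (∑-blocks p (h ∘ γA)) (∑-blocks p (h ∘ γB)) ⟩
    ∑[ t < p * M ] h (γA t) + ∑[ t < p * M ] h (γB t)
      ≤⟨ +-mono-≤ (∑-within A γA γA-inj (λ _ → enum-∈ A _) h)
                  (∑-within B γB γB-inj (λ _ → enum-∈ B _) h) ⟩
    ∑[ y < n ] (𝟙 (y ∈? A) * h y) + ∑[ y < n ] (𝟙 (y ∈? B) * h y)
      ≡⟨ ∑-distrib-+ (λ y → 𝟙 (y ∈? A) * h y) (λ y → 𝟙 (y ∈? B) * h y) ⟨
    ∑[ y < n ] (𝟙 (y ∈? A) * h y + 𝟙 (y ∈? B) * h y)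
      ≤⟨ ∑-mono (λ y → ≤-trans (≤-reflexive (sym (*-distribʳ-+ (h y) (𝟙 (y ∈? A)) _)))
                               (*-monoˡ-≤ (h y) (𝟙-∪ A B disjoint y))) ⟩
    ∑[ y < n ] (𝟙 (y ∈? A ∪ B) * h y)
      ≤⟨ budget (enum-∈ A _) (enum-∈ B _) ⟩
    D
      ∎
    where
    open ≤-Reasoning
    h : Fin n → ℕ
    h = g (α i u) (β j u′)

  from-transversal : (∃[ v ] ∃[ w ] ∀ i j k → g (α i (v i)) (β j (w j)) (α k (v k)) ≡ 0 ×
                                                g (α i (v i)) (β j (w j)) (β k (w k)) ≡ 0) →
    WeightlessSubpair g p A B
  from-transversal (v , w , zeros) =
    weightless-images g (λ i → α i (v i)) (λ j → β j (w j))
      (λ eq → combine-injectiveˡ _ _ _ _ (γA-inj eq)) (λ eq → combine-injectiveˡ _ _ _ _ (γB-inj eq))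
      (λ _ → enum-∈ A _) (λ _ → enum-∈ B _) zeros

remaining≤ : ∀ L ℓ → L + 7 ≤ 2 * ℓ → L ∸ (ℓ ∸ 3) ≤ ℓ
remaining≤ L ℓ bound = m≤n+o⇒m∸n≤o L (ℓ ∸ 3) (+-cancelˡ-≤ 3 L _ (begin
  3 + L                ≤⟨ +-monoˡ-≤ L (s≤s (s≤s (s≤s z≤n))) ⟩
  7 + L                ≡⟨ +-comm 7 L ⟩
  L + 7                ≤⟨ bound ⟩
  2 * ℓ                ≡⟨ cong (ℓ +_) (+-identityʳ ℓ) ⟩
  ℓ + ℓ                ≤⟨ +-monoˡ-≤ ℓ (m≤n+m∸n ℓ 3) ⟩
  3 + (ℓ ∸ 3) + ℓ      ≡⟨ +-assoc 3 (ℓ ∸ 3) ℓ ⟩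
  3 + ((ℓ ∸ 3) + ℓ)    ∎))
  where open ≤-Reasoning

module Paths {n : ℕ} (G : OrderedGraph n) where
  open OrderedGraph G

  walk-cons : ∀ {a x b ws} → E a x → Walk G x b ws → Walk G a b (a ∷ ws)
  walk-cons a~x here         = step a~x here
  walk-cons a~x (step e w)   = step a~x (step e w)

  walk-snoc : ∀ {a b c ws} → Walk G a b ws → E b c → Walk G a c (ws ++ c ∷ [])
  walk-snoc here       b~c = step b~c here
  walk-snoc (step e w) b~c = step e (walk-snoc w b~c)

  walk-reverse : ∀ {a b vs} → Walk G a b vs → Walk G b a (reverse vs)
  walk-reverse here = here
  walk-reverse {a} (step {x = x} {vs = vs} a~x w) =
    subst (Walk G _ a) (sym (unfold-reverse a (x ∷ vs))) (walk-snoc (walk-reverse w) (E-sym a~x))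

  len-reverse : ∀ (vs : List (Fin n)) → len G (reverse vs) ≡ len G vs
  len-reverse vs = cong (_∸ 1) (length-reverse vs)

  dist-sym : ∀ {x y k} → DistLe G x y k → DistLe G y x k
  dist-sym {k = k} (vs , w , len≤) =
    reverse vs , walk-reverse w , subst (_≤ k) (sym (len-reverse vs)) len≤

  dist-mono : ∀ {x y k k′} → k ≤ k′ → DistLe G x y k → DistLe G x y k′
  dist-mono k≤k′ (vs , w , len≤) = vs , w , ≤-trans len≤ k≤k′

  walk-split : ∀ {x y W} → Walk G x y W → ∀ j {c} → at G W j ≡ just c →
               DistLe G x c j × DistLe G c y (len G W ∸ j)
  walk-split here       zero    refl = (_ , here , z≤n) , (_ , here , z≤n)
  walk-split (step e w) zero    refl = (_ , here , z≤n) , (_ , step e w , ≤-refl)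
  walk-split (step e w) (suc j) at≡c with walk-split w j at≡c
  ... | (ws , w₁ , len₁) , rest = (_ , walk-cons e w₁ , pred-bound (length ws) len₁) , rest
    where
    pred-bound : ∀ m → m ∸ 1 ≤ j → m ≤ suc j
    pred-bound zero    _  = z≤n
    pred-bound (suc m) le = s≤s le

  critical-near-ends : ∀ {ℓ x y W c} → Walk G x y W → len G W + 7 ≤ 2 * ℓ →
                       at G W (ℓ ∸ 3) ≡ just c → DistLe G c x ℓ × DistLe G c y ℓ
  critical-near-ends {ℓ} {W = W} w bound at≡c with walk-split w (ℓ ∸ 3) at≡c
  ... | to-c , from-c =
    dist-mono (m∸n≤m ℓ 3) (dist-sym to-c) , dist-mono (remaining≤ (len G W) ℓ bound) from-c

  <R-asym : ∀ {xs ys} → _<R_ G xs ys → _<R_ G ys xs → ⊥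
  <R-asym (same< p)  (same< q)  = <R-asym p q
  <R-asym (same< _)  (last< lt) = <-irrefl refl lt
  <R-asym (last< lt) (same< _)  = <-irrefl refl lt
  <R-asym (last< a)  (last< b)  = <-asym a b

  -- P_ab is unique: two minimum-length candidates are comparable both ways.
  IsP-unique : ∀ {a b P Q} → IsP G a b P → IsP G a b Q → P ≡ Q
  IsP-unique {P = P} {Q} (wP , minP , tieP) (wQ , minQ , tieQ)
    with tieP Q wQ (≤-antisym (minQ P wP) (minP Q wQ)) | tieQ P wP (≤-antisym (minP Q wQ) (minQ P wP))
  ... | inj₁ P≡Q | _        = P≡Q
  ... | inj₂ _   | inj₁ Q≡P = sym Q≡P
  ... | inj₂ P<Q | inj₂ Q<P = ⊥-elim (<R-asym P<Q Q<P)

module CriticalBalls {n : ℕ} (G : OrderedGraph n) (ℓ : ℕ) where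
  open OrderedGraph G
  open Paths G

  -- A selector picks the end of P_ab from which the critical vertex is counted:
  -- id gives c_ab, reverse gives c_ba.
  Selector : Set
  Selector = List (Fin n) → List (Fin n)

  record InCriticalBall (sel : Selector) (a b y : Fin n) : Set where
    constructor critical
    field
      path      : List (Fin n)
      centre    : Fin n
      is-P      : IsP G a b path
      at-centre : at G (sel path) (ℓ ∸ 3) ≡ just centre
      near      : InBall G centre ℓ y

  Stray : Selector → Fin n → Fin n → Fin n → Set
  Stray sel a b y = InCriticalBall sel a b y × y ≢ a × y ≢ b

  stray? : ∀ {sel a b} → (∀ y → Dec (InCriticalBall sel a b y)) → ∀ y → Dec (Stray sel a b y)
  stray? {a = a} {b} crit? y = crit? y ×-dec (¬? (y ≟ a) ×-dec ¬? (y ≟ b))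

  localized-sub : ∀ d {A B A′ B′} → Localized G ℓ d A B → A′ ⊆ A → B′ ⊆ B → Localized G ℓ d A′ B′
  localized-sub d (far , close) A′⊆A B′⊆B =
    (λ x y x∈ y∈ → far x y (∪-mono A′⊆A B′⊆B x∈) (∪-mono A′⊆A B′⊆B y∈)) ,
    (λ a b a∈ b∈ → close a b (A′⊆A a∈) (B′⊆B b∈))

  -- In a localized pair, P_ab has length at most 2ℓ - 2^(d+2) - 3 ≤ 2ℓ - 7.
  path-short : ∀ d A B {a b P} → Localized G ℓ d A B → a ∈ A → b ∈ B → IsP G a b P →
               len G P + 7 ≤ 2 * ℓ
  path-short d A B {a} {b} {P} (_ , close) a∈ b∈ (_ , minimal , _) with close a b a∈ b∈
  ... | k , bound , W , w , lenW≤k = begin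
    len G P + 7           ≤⟨ +-monoˡ-≤ 7 (≤-trans (minimal W w) lenW≤k) ⟩
    k + 7                 ≡⟨ +-assoc k 4 3 ⟨
    k + 4 + 3             ≤⟨ +-monoˡ-≤ 3 (+-monoʳ-≤ k (^-monoʳ-≤ 2 (m≤n+m 2 d))) ⟩
    k + 2 ^ (d + 2) + 3   ≤⟨ bound ⟩
    2 * ℓ                 ∎
    where open ≤-Reasoning

  Endpoints : Selector → Fin n → Fin n → Set
  Endpoints sel a b = ∀ {P c} → IsP G a b P → at G (sel P) (ℓ ∸ 3) ≡ just c →
                      InBall G c ℓ a × InBall G c ℓ b

  endpoints-ab : ∀ d A B {a b} → Localized G ℓ d A B → a ∈ A → b ∈ B → Endpoints id a b
  endpoints-ab d A B loc a∈ b∈ isP = critical-near-ends (proj₁ isP) (path-short d A B loc a∈ b∈ isP)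

  endpoints-ba : ∀ d A B {a b} → Localized G ℓ d A B → a ∈ A → b ∈ B → Endpoints reverse a b
  endpoints-ba d A B loc a∈ b∈ {P} isP at≡c =
    swap (critical-near-ends (walk-reverse (proj₁ isP))
            (subst (λ L → L + 7 ≤ 2 * ℓ) (sym (len-reverse P)) (path-short d A B loc a∈ b∈ isP)) at≡c)

  -- A sparse pair with a vertex x has d ≥ 1, since B(x, ℓ) contains x.
  sparse-positive : ∀ d A B → Sparse G ℓ d A B → ∀ {x} → x ∈ A ∪ B → 0 < d
  sparse-positive d A B sparse {x} x∈ = begin-strict
    0            <⟨ s≤s z≤n ⟩
    1            ≡⟨ ∣⁅x⁆∣≡1 x ⟨
    ∣ ⁅ x ⁆ ∣    ≤⟨ sparse x ⁅ x ⁆ (λ y∈ → subst (_∈ A ∪ B) (sym (x∈⁅y⁆⇒x≡y x y∈)) x∈)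
                          (λ y y∈ → subst (λ z → InBall G z ℓ x) (sym (x∈⁅y⁆⇒x≡y x y∈))
                                          (_ , here , z≤n)) ⟩
    d            ∎
    where open ≤-Reasoning

  module _ (d : ℕ) (A B : Subset n) (sparse : Sparse G ℓ d A B) (sel : Selector) {a b : Fin n}
           (crit? : ∀ y → Dec (InCriticalBall sel a b y)) where

    in-ball? : ∀ y → Dec (y ∈ A ∪ B × InCriticalBall sel a b y)
    in-ball? y = (y ∈? A ∪ B) ×-dec crit? y

    stray≤in-ball : ∀ y → 𝟙 (y ∈? A ∪ B) * 𝟙 (stray? crit? y) ≤ 𝟙 (in-ball? y)
    stray≤in-ball y = 𝟙-∧ (y ∈? A ∪ B) (stray? crit? y) (in-ball? y) (λ y∈ s → y∈ , proj₁ s)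

    -- By sparsity the critical ball of (a, b) meets A ∪ B in at most d vertices; as
    -- one of them is a, fewer than d of them are stray.
    stray-budget : a ∈ A ∪ B → Endpoints sel a b → ∑[ y < n ] (𝟙 (y ∈? A ∪ B) * 𝟙 (stray? crit? y)) < d
    stray-budget a∈ ends with any? in-ball?
    ... | no nothing-in-ball = begin-strict
      ∑[ y < n ] (𝟙 (y ∈? A ∪ B) * 𝟙 (stray? crit? y))
        ≤⟨ ∑-mono (λ y → ≤-trans (stray≤in-ball y)
                                 (≤-reflexive (𝟙-no (in-ball? y) (nothing-in-ball ∘ (y ,_))))) ⟩
      ∑[ y < n ] 0
        ≡⟨ trans (∑-const n 0) (*-zeroʳ n) ⟩
      0
        <⟨ sparse-positive d A B sparse a∈ ⟩
      d ∎
      where open ≤-Reasoning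
    ... | yes (_ , _ , critical P c isP at≡c _) = begin-strict
      ∑[ y < n ] (𝟙 (y ∈? A ∪ B) * 𝟙 (stray? crit? y))
        <⟨ ∑-mono-< a a-not-stray stray≤in-ball ⟩
      ∑[ y < n ] 𝟙 (in-ball? y)
        ≡⟨ ∣collect∣ in-ball? ⟨
      ∣ collect in-ball? ∣
        ≤⟨ sparse c (collect in-ball?) (proj₁ ∘ ∈-collect⁻ in-ball?)
                  (λ x → dist-sym ∘ around-c x ∘ ∈-collect⁻ in-ball?) ⟩
      d ∎
      where
      open ≤-Reasoning
      -- P_ab is unique, so every critical ball of (a, b) is the ball around c.
      around-c : ∀ x → x ∈ A ∪ B × InCriticalBall sel a b x → InBall G c ℓ x
      around-c x (_ , critical P′ c′ isP′ at≡c′ c′~x) with IsP-unique isP isP′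
      ... | refl with trans (sym at≡c) at≡c′
      ...   | refl = c′~x
      a-not-stray : 𝟙 (a ∈? A ∪ B) * 𝟙 (stray? crit? a) < 𝟙 (in-ball? a)
      a-not-stray = begin-strict
        𝟙 (a ∈? A ∪ B) * 𝟙 (stray? crit? a)
          ≡⟨ cong (𝟙 (a ∈? A ∪ B) *_) (𝟙-no (stray? crit? a) (λ s → proj₁ (proj₂ s) refl)) ⟩
        𝟙 (a ∈? A ∪ B) * 0
          ≡⟨ *-zeroʳ (𝟙 (a ∈? A ∪ B)) ⟩
        0
          <⟨ s≤s z≤n ⟩
        1
          ≡⟨ 𝟙-yes (in-ball? a) (a∈ , critical P c isP at≡c (proj₁ (ends isP at≡c))) ⟨
        𝟙 (in-ball? a)
          ∎

  ball-meets : ∀ {A′ B′} sel {a b} (crit? : ∀ y → Dec (InCriticalBall sel a b y)) → Endpoints sel a b →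
               (∀ {y} → y ∈ A′ ∪ B′ → 𝟙 (stray? crit? y) ≡ 0) →
               ∀ P → IsP G a b P → ∀ c → at G (sel P) (ℓ ∸ 3) ≡ just c → BallMeets G ℓ A′ B′ c a b
  ball-meets sel {a} {b} crit? ends no-stray P isP c at≡c y y∈ = mk⇔ in-ball⇒end end⇒in-ball
    where
    end⇒in-ball : y ≡ a ⊎ y ≡ b → InBall G c ℓ y
    end⇒in-ball (inj₁ refl) = proj₁ (ends isP at≡c)
    end⇒in-ball (inj₂ refl) = proj₂ (ends isP at≡c)
    in-ball⇒end : InBall G c ℓ y → y ≡ a ⊎ y ≡ b
    in-ball⇒end c~y with y ≟ a | y ≟ b
    ... | yes y≡a | _       = inj₁ y≡a
    ... | no _    | yes y≡b = inj₂ y≡b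
    ... | no y≢a  | no y≢b  = contradiction
      (trans (sym (𝟙-yes (stray? crit? y) (critical P c isP at≡c c~y , y≢a , y≢b))) (no-stray y∈)) 1+n≢0

  module Weights (crit-ab? : ∀ a b y → Dec (InCriticalBall id a b y))
                 (crit-ba? : ∀ a b y → Dec (InCriticalBall reverse a b y)) where

    weight : Fin n → Fin n → Fin n → ℕ
    weight a b y = 𝟙 (stray? (crit-ab? a b) y) + 𝟙 (stray? (crit-ba? a b) y)

    weight-a : ∀ a b → weight a b a ≡ 0
    weight-a a b = cong₂ _+_ (𝟙-no (stray? (crit-ab? a b) a) (λ s → proj₁ (proj₂ s) refl))
                             (𝟙-no (stray? (crit-ba? a b) a) (λ s → proj₁ (proj₂ s) refl))

    weight-b : ∀ a b → weight a b b ≡ 0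
    weight-b a b = cong₂ _+_ (𝟙-no (stray? (crit-ab? a b) b) (λ s → proj₂ (proj₂ s) refl))
                             (𝟙-no (stray? (crit-ba? a b) b) (λ s → proj₂ (proj₂ s) refl))

    weight-budget : ∀ d A B → Sparse G ℓ d A B → Localized G ℓ d A B → ∀ {a b} → a ∈ A → b ∈ B →
                    ∑[ y < n ] (𝟙 (y ∈? A ∪ B) * weight a b y) ≤ pred d + pred d
    weight-budget d A B sparse loc {a} {b} a∈ b∈ = begin
      ∑[ y < n ] (𝟙 (y ∈? A ∪ B) * weight a b y)
        ≡⟨ sum-cong-≗ (λ y → *-distribˡ-+ (𝟙 (y ∈? A ∪ B)) _ _) ⟩
      ∑[ y < n ] (strays-ab y + strays-ba y)
        ≡⟨ ∑-distrib-+ strays-ab strays-ba ⟩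
      sum strays-ab + sum strays-ba
        ≤⟨ +-mono-≤ (<⇒≤pred (stray-budget d A B sparse id (crit-ab? a b) a∈AB
                                           (endpoints-ab d A B loc a∈ b∈)))
                    (<⇒≤pred (stray-budget d A B sparse reverse (crit-ba? a b) a∈AB
                                           (endpoints-ba d A B loc a∈ b∈))) ⟩
      pred d + pred d
        ∎
      where
      open ≤-Reasoning
      a∈AB : a ∈ A ∪ B
      a∈AB = p⊆p∪q B a∈
      strays-ab strays-ba : Fin n → ℕ
      strays-ab y = 𝟙 (y ∈? A ∪ B) * 𝟙 (stray? (crit-ab? a b) y)
      strays-ba y = 𝟙 (y ∈? A ∪ B) * 𝟙 (stray? (crit-ba? a b) y)

    weightless⇒independent : ∀ d p A B → Localized G ℓ d A B → WeightlessSubpair weight p A B →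
                             HasIndepSubpair G ℓ d p A B
    weightless⇒independent d p A B loc (A′ , B′ , A′⊆A , B′⊆B , ∣A′∣≡p , ∣B′∣≡p , weightless) =
      A′ , B′ , A′⊆A , B′⊆B , independent , trans (cong₂ _⊓_ ∣A′∣≡p ∣B′∣≡p) (⊓-idem p)
      where
      independent : Independent G ℓ d A′ B′
      independent =
        localized-sub d loc A′⊆A B′⊆B ,
        λ a b a∈ b∈ P isP →
          ball-meets id (crit-ab? a b) (endpoints-ab d A B loc (A′⊆A a∈) (B′⊆B b∈))
                     (λ y∈ → m+n≡0⇒m≡0 _ (weightless a∈ b∈ y∈)) P isP ,
          ball-meets reverse (crit-ba? a b) (endpoints-ba d A B loc (A′⊆A a∈) (B′⊆B b∈))
                     (λ y∈ → m+n≡0⇒n≡0 _ (weightless a∈ b∈ y∈)) P isP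

p≤2p³ : ∀ p → p ≤ 2 * (p * (p * p))
p≤2p³ zero    = z≤n
p≤2p³ (suc k) = ≤-trans (m≤m*n (suc k) (suc k * suc k)) (m≤m+n _ _)

-- With d = d′ + 1 and blocks of size M = 2d′p² + 1, p blocks fit into 2dp³ vertices.
blocks-fit : ∀ p d′ → p * suc (p * p * (d′ + d′)) ≤ 2 * suc d′ * p ^ 3
blocks-fit p d′ = begin
  p * suc (p * p * (d′ + d′))                      ≡⟨ *-suc p _ ⟩
  p + p * (p * p * (d′ + d′))                      ≤⟨ +-monoˡ-≤ _ (p≤2p³ p) ⟩
  2 * (p * (p * p)) + p * (p * p * (d′ + d′))      ≡⟨ expand p d′ ⟩
  2 * suc d′ * p ^ 3                               ∎
  where
  open ≤-Reasoning
  expand : ∀ p d → 2 * (p * (p * p)) + p * (p * p * (d + d)) ≡ 2 * suc d * (p * (p * (p * 1)))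
  expand = solve-∀

¬¬-∀ : ∀ {m} {Q : Fin m → Set} → (∀ i → ¬ ¬ Q i) → ¬ ¬ (∀ i → Q i)
¬¬-∀ {zero}  _    k = k (λ ())
¬¬-∀ {suc m} ¬¬Q k = ¬¬Q zero (λ q₀ → ¬¬-∀ (¬¬Q ∘ suc) (λ q → k λ { zero → q₀ ; (suc i) → q i }))

¬¬-decidable³ : ∀ {n} {R : Fin n → Fin n → Fin n → Set} → ¬ ¬ (∀ a b y → Dec (R a b y))
¬¬-decidable³ = ¬¬-∀ (λ a → ¬¬-∀ (λ b → ¬¬-∀ (λ y → ¬¬-excluded-middle)))

independent-subpair : ∀ {n} (G : OrderedGraph n) (d ℓ p : ℕ) (A B : Subset n) →
  (crit-ab? : ∀ a b y → Dec (CriticalBalls.InCriticalBall G ℓ id a b y)) →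
  (crit-ba? : ∀ a b y → Dec (CriticalBalls.InCriticalBall G ℓ reverse a b y)) →
  Disjoint G A B → Sparse G ℓ d A B → Localized G ℓ d A B →
  2 * d * p ^ 3 < size G A B → HasIndepSubpair G ℓ d p A B
independent-subpair G zero ℓ p A B _ _ _ sparse _ large = ⊥-elim (<-irrefl refl
  (CriticalBalls.sparse-positive G ℓ 0 A B sparse (p⊆p∪q B (enum-∈ A (fromℕ< A-nonempty)))))
  where
  -- for d = 0, A has an element, but 0-sparsity allows no vertex at all
  A-nonempty : 0 < ∣ A ∣
  A-nonempty = ≤-trans large (m⊓n≤m _ _)
independent-subpair G (suc d′) ℓ p A B crit-ab? crit-ba? disjoint sparse loc large =
  weightless⇒independent (suc d′) p A B loc
    (select A B disjoint weight weight-a weight-b (d′ + d′) (weight-budget (suc d′) A B sparse loc)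
            p (suc (p * p * (d′ + d′))) (fits (m⊓n≤m _ _)) (fits (m⊓n≤n _ _)) ≤-refl)
  where
  open CriticalBalls.Weights G ℓ crit-ab? crit-ba?
  fits : ∀ {s} → size G A B ≤ s → p * suc (p * p * (d′ + d′)) ≤ s
  fits size≤s = ≤-trans (<⇒≤ (≤-<-trans (blocks-fit p d′) large)) size≤s

-- If the size exceeded 2dp³, deciding the critical balls (possible under ¬¬) would
-- yield an independent subpair of size p.
lemma20 : ∀ {n : ℕ} (G : OrderedGraph n) (d ℓ p : ℕ) (A B : Subset n) →
          Disjoint G A B → Sparse G ℓ d A B → Localized G ℓ d A B →
          ¬ HasIndepSubpair G ℓ d p A B →
          size G A B ≤ 2 * d * p ^ 3
lemma20 G d ℓ p A B disjoint sparse loc no-subpair with size G A B ≤? 2 * d * p ^ 3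
... | yes small = small
... | no large  = ⊥-elim (¬¬-decidable³ λ crit-ab? → ¬¬-decidable³ λ crit-ba? →
  no-subpair (independent-subpair G d ℓ p A B crit-ab? crit-ba? disjoint sparse loc (≰⇒> large)))
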